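{- Let $n\ge 3$ be an even integer and let $\mathcal{F}$ be a 1-factorisation of $Circ(2n,\{1,2\})$. Then the configurations alternate between 2-configurations and 3-configurations: for every $v\in\mathbb{Z}_{2n}$, exactly one of $C_{\{v,v+1\}}$ and $C_{\{v+1,v+2\}}$ is a 2-configuration and the other is a 3-configuration.
   Context: For a positive integer $N$ and $D\subseteq\{1,\dots,\lfloor N/2\rfloor\}$, the circulant graph $Circ(N,D)$ has vertex set $\mathbb{Z}_N$, with $u,v$ adjacent iff $u-v\equiv \pm d \pmod N$ for some $d\in D$. A 1-factor is a 1-regular spanning subgraph; a 1-factorisation is a partition of the edge set into 1-factors; regard a 1-factorisation as an edge colouring in which each 1-factor is a colour class. In $Circ(2n,\{1,2\})$ (arithmetic mod $2n$), a 1-edge is an edge $\{v,v+1\}$ and a 2-edge is an edge $\{v,v+2\}$. The configuration of the 1-edge $e=\{v,v+1\}$ is $C_e=\{\{v-1,v+1\},\{v,v+1\},\{v,v+2\}\}$; it is a $k$-configuration if exactly $k$ distinct colours (1-factors) occur on its three edges. -}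

module Defs where

open import Data.Nat using (ℕ; zero; suc; _+_; _*_; _∸_)
open import Data.Nat.DivMod using (_mod_)
open import Data.Fin using (Fin; toℕ)
open import Data.Product using (Σ; _×_; _,_)
open import Data.Sum using (_⊎_)
open import Relation.Binary.PropositionalEquality using (_≡_; _≢_)

_+ᵥ_ : ∀ {N} → Fin N → ℕ → Fin N
_+ᵥ_ {suc m} v k = (toℕ v + k) mod (suc m)

pred-v : ∀ {N} → Fin N → Fin N
pred-v {N} v = v +ᵥ (N ∸ 1)

-- Edges of Circ(N,{1,2}) (for N ≥ 5 these representations are distinct edges):
--   one v  is the 1-edge {v, v+1},   two v  is the 2-edge {v, v+2}.
data Edge (N : ℕ) : Set where
  one : Fin N → Edge N
  two : Fin N → Edge N

Incident : ∀ {N} → Fin N → Edge N → Set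
Incident u (one v) = u ≡ v ⊎ u ≡ v +ᵥ 1
Incident u (two v) = u ≡ v ⊎ u ≡ v +ᵥ 2

-- An edge colouring col is a 1-factorisation: every colour class (of a colour
-- that actually occurs) is a 1-factor, i.e. every vertex is incident with
-- exactly one edge of that colour.
IsOneFactorisation : ∀ {N k} → (Edge N → Fin k) → Set
IsOneFactorisation {N} col =
  (e : Edge N) (u : Fin N) →
    Σ (Edge N) λ f → (Incident u f × col f ≡ col e) ×
      ((g : Edge N) → Incident u g → col g ≡ col e → g ≡ f)

Three : ∀ {k} → Fin k → Fin k → Fin k → Set
Three a b c = a ≢ b × b ≢ c × a ≢ c

Two : ∀ {k} → Fin k → Fin k → Fin k → Set
Two a b c = (a ≡ b × b ≢ c) ⊎ (b ≡ c × a ≢ b) ⊎ (a ≡ c × a ≢ b)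

-- The configuration of the 1-edge {v,v+1}:
--   C = {{v-1,v+1}, {v,v+1}, {v,v+2}} = {two (v-1), one v, two v}.
Is2Config : ∀ {N k} → (Edge N → Fin k) → Fin N → Set
Is2Config col v = Two (col (two (pred-v v))) (col (one v)) (col (two v))

Is3Config : ∀ {N k} → (Edge N → Fin k) → Fin N → Set
Is3Config col v = Three (col (two (pred-v v))) (col (one v)) (col (two v))

module Submission where

open import Defs
open import Data.Nat using (ℕ; suc; _+_; _*_; _∸_; _%_; _/_; _≤_; _<_; z≤n; s≤s)
open import Data.Nat.DivMod using (m%n<n; m≡m%n+[m/n]*n; %-distribˡ-+; m%n%n≡m%n; [m+n]%n≡m%n; m<n⇒m%n≡m)
open import Data.Nat.Divisibility using (_∣_; divides; ∣⇒≤)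
open import Data.Nat.Properties using (+-assoc; +-suc; +-cancelˡ-≡; m+[n∸m]≡n; <⇒≱; <⇒≤; ≤-trans; m≤m+n)
open import Data.Fin using (Fin; toℕ)
open import Data.Fin.Properties using (toℕ-fromℕ<; toℕ-injective; toℕ<n)
open import Data.Product using (_×_; _,_)
open import Data.Sum using (_⊎_; inj₁; inj₂)
open import Data.Empty using (⊥-elim)
open import Relation.Binary.PropositionalEquality
  using (_≡_; _≢_; refl; sym; trans; cong; module ≡-Reasoning)

-- The colour of the 2-edge {v,v+2} must occur at the vertex v+1.  Both
-- 1-edges at v+1 meet {v,v+2}, so that colour sits on {v-1,v+1} (making
-- C_{v,v+1} a 2-configuration) or on {v+1,v+3} (making C_{v+1,v+2} one).
-- Every other pair of edges in the two configurations shares a vertex, and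
-- {v-1,v+1}, {v+1,v+3} differ once 2n ≥ 3, so exactly one case occurs.

module _ {N k} {col : Edge N → Fin k} (isFactorisation : IsOneFactorisation col) where

  incident⇒col≢ : ∀ {u e f} → Incident u e → Incident u f → e ≢ f → col e ≢ col f
  incident⇒col≢ {u} {e} {f} u∈e u∈f e≢f ce≡cf with isFactorisation e u
  ... | _ , _ , unique = e≢f (trans (unique e u∈e refl) (sym (unique f u∈f (sym ce≡cf))))

two-injective : ∀ {N} {x y : Fin N} → two x ≡ two y → x ≡ y
two-injective refl = refl

module Cyclic (m : ℕ) where

  N : ℕ
  N = suc m

  toℕ-+ᵥ : (x : Fin N) (a : ℕ) → toℕ (x +ᵥ a) ≡ (toℕ x + a) % N
  toℕ-+ᵥ x a = toℕ-fromℕ< (m%n<n (toℕ x + a) N)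

  +ᵥ-assoc : (x : Fin N) (a b : ℕ) → (x +ᵥ a) +ᵥ b ≡ x +ᵥ (a + b)
  +ᵥ-assoc x a b = toℕ-injective (begin
    toℕ ((x +ᵥ a) +ᵥ b)                 ≡⟨ toℕ-+ᵥ (x +ᵥ a) b ⟩
    (toℕ (x +ᵥ a) + b) % N              ≡⟨ cong (λ y → (y + b) % N) (toℕ-+ᵥ x a) ⟩
    ((t + a) % N + b) % N               ≡⟨ %-distribˡ-+ ((t + a) % N) b N ⟩
    ((t + a) % N % N + b % N) % N       ≡⟨ cong (λ y → (y + b % N) % N) (m%n%n≡m%n (t + a) N) ⟩
    ((t + a) % N + b % N) % N           ≡⟨ %-distribˡ-+ (t + a) b N ⟨
    (t + a + b) % N                     ≡⟨ cong (_% N) (+-assoc t a b) ⟩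
    (t + (a + b)) % N                   ≡⟨ toℕ-+ᵥ x (a + b) ⟨
    toℕ (x +ᵥ (a + b))                  ∎)
    where
    open ≡-Reasoning
    t : ℕ
    t = toℕ x

  +ᵥ-period : (x : Fin N) → x +ᵥ N ≡ x
  +ᵥ-period x = toℕ-injective (begin
    toℕ (x +ᵥ N)      ≡⟨ toℕ-+ᵥ x N ⟩
    (toℕ x + N) % N   ≡⟨ [m+n]%n≡m%n (toℕ x) N ⟩
    toℕ x % N         ≡⟨ m<n⇒m%n≡m (toℕ<n x) ⟩
    toℕ x             ∎)
    where open ≡-Reasoning

  +ᵥ-inverseʳ : ∀ {c} → c ≤ N → (x : Fin N) → (x +ᵥ c) +ᵥ (N ∸ c) ≡ x
  +ᵥ-inverseʳ {c} c≤N x = begin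
    (x +ᵥ c) +ᵥ (N ∸ c)  ≡⟨ +ᵥ-assoc x c (N ∸ c) ⟩
    x +ᵥ (c + (N ∸ c))   ≡⟨ cong (x +ᵥ_) (m+[n∸m]≡n c≤N) ⟩
    x +ᵥ N               ≡⟨ +ᵥ-period x ⟩
    x                    ∎
    where open ≡-Reasoning

  +ᵥ-cancelʳ : ∀ {c} → c ≤ N → {x y : Fin N} → x +ᵥ c ≡ y +ᵥ c → x ≡ y
  +ᵥ-cancelʳ {c} c≤N {x} {y} eq = begin
    x                    ≡⟨ +ᵥ-inverseʳ c≤N x ⟨
    (x +ᵥ c) +ᵥ (N ∸ c)  ≡⟨ cong (_+ᵥ (N ∸ c)) eq ⟩
    (y +ᵥ c) +ᵥ (N ∸ c)  ≡⟨ +ᵥ-inverseʳ c≤N y ⟩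
    y                    ∎
    where open ≡-Reasoning

  pred-v-+ᵥ1 : (x : Fin N) → pred-v (x +ᵥ 1) ≡ x
  pred-v-+ᵥ1 = +ᵥ-inverseʳ (s≤s z≤n)

  pred-v-+ᵥ2 : (x : Fin N) → pred-v x +ᵥ 2 ≡ x +ᵥ 1
  pred-v-+ᵥ2 x = begin
    (x +ᵥ m) +ᵥ 2   ≡⟨ +ᵥ-assoc x m 2 ⟩
    x +ᵥ (m + 2)    ≡⟨ cong (x +ᵥ_) (+-suc m 1) ⟩
    x +ᵥ (N + 1)    ≡⟨ +ᵥ-assoc x N 1 ⟨
    (x +ᵥ N) +ᵥ 1   ≡⟨ cong (_+ᵥ 1) (+ᵥ-period x) ⟩
    x +ᵥ 1          ∎
    where open ≡-Reasoning

  -- x + c ≡ x forces N ∣ c, impossible for 0 < c < N.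
  +ᵥ-fixedPointFree : ∀ {c} → 0 < c → c < N → (x : Fin N) → x ≢ x +ᵥ c
  +ᵥ-fixedPointFree {c@(suc _)} _ c<N x x≡x+c = <⇒≱ c<N (∣⇒≤ (divides ((t + c) / N) c≡qN))
    where
    open ≡-Reasoning
    t : ℕ
    t = toℕ x
    c≡qN : c ≡ (t + c) / N * N
    c≡qN = +-cancelˡ-≡ t c _ (begin
      t + c                          ≡⟨ m≡m%n+[m/n]*n (t + c) N ⟩
      (t + c) % N + (t + c) / N * N  ≡⟨ cong (_+ (t + c) / N * N) (toℕ-+ᵥ x c) ⟨
      toℕ (x +ᵥ c) + (t + c) / N * N ≡⟨ cong (λ y → toℕ y + (t + c) / N * N) x≡x+c ⟨
      t + (t + c) / N * N            ∎)

colours-alternate : ∀ {k} {a o b o′ d : Fin k} →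
  a ≢ o → o ≢ b → b ≢ o′ → o′ ≢ d → a ≢ d → b ≡ a ⊎ b ≡ d →
  (Two a o b × Three b o′ d) ⊎ (Three a o b × Two b o′ d)
colours-alternate a≢o o≢b b≢o′ o′≢d a≢d (inj₁ refl) =
  inj₁ (inj₂ (inj₂ (refl , a≢o)) , b≢o′ , o′≢d , a≢d)
colours-alternate a≢o o≢b b≢o′ o′≢d a≢d (inj₂ refl) =
  inj₂ ((a≢o , o≢b , a≢d) , inj₂ (inj₂ (refl , b≢o′)))

module Configurations (m : ℕ) (2<N : 2 < suc m) {k} {col : Edge (suc m) → Fin k}
                      (isFactorisation : IsOneFactorisation col) (v : Fin (suc m)) where
  open Cyclic m

  private
    p w : Fin (suc m)
    p = pred-v v
    w = v +ᵥ 1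

    w∈two-p : Incident w (two p)
    w∈two-p = inj₂ (sym (pred-v-+ᵥ2 v))

    v+2∈one-w : Incident (v +ᵥ 2) (one w)
    v+2∈one-w = inj₂ (sym (+ᵥ-assoc v 1 1))

    col≢ : ∀ {u e f} → Incident u e → Incident u f → e ≢ f → col e ≢ col f
    col≢ = incident⇒col≢ isFactorisation

  two-p≢one-v : col (two p) ≢ col (one v)
  two-p≢one-v = col≢ w∈two-p (inj₂ refl) λ ()

  one-v≢two-v : col (one v) ≢ col (two v)
  one-v≢two-v = col≢ (inj₁ refl) (inj₁ refl) λ ()

  two-v≢one-w : col (two v) ≢ col (one w)
  two-v≢one-w = col≢ (inj₂ refl) v+2∈one-w λ ()

  one-w≢two-w : col (one w) ≢ col (two w)
  one-w≢two-w = col≢ (inj₁ refl) (inj₁ refl) λ ()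

  two-p≢two-w : col (two p) ≢ col (two w)
  two-p≢two-w = col≢ w∈two-p (inj₁ refl) λ eq →
    +ᵥ-fixedPointFree (s≤s z≤n) 2<N p (trans (two-injective eq) (sym (pred-v-+ᵥ2 v)))

  two-v-colour-repeats : col (two v) ≡ col (two p) ⊎ col (two v) ≡ col (two w)
  two-v-colour-repeats with isFactorisation (two v) w
  ... | one x , (inj₁ refl , c) , _ = ⊥-elim (two-v≢one-w (sym c))
  ... | one x , (inj₂ w≡x+1 , c) , _ with +ᵥ-cancelʳ (s≤s z≤n) {v} {x} w≡x+1
  ...   | refl = ⊥-elim (one-v≢two-v c)
  two-v-colour-repeats | two x , (inj₁ refl , c) , _ = inj₂ (sym c)
  two-v-colour-repeats | two x , (inj₂ w≡x+2 , c) , _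
    with +ᵥ-cancelʳ (<⇒≤ 2<N) {p} {x} (trans (pred-v-+ᵥ2 v) w≡x+2)
  ... | refl = inj₁ (sym c)

  configurations-alternate :
    (Is2Config col v × Is3Config col w) ⊎ (Is3Config col v × Is2Config col w)
  configurations-alternate rewrite pred-v-+ᵥ1 v =
    colours-alternate two-p≢one-v one-v≢two-v two-v≢one-w one-w≢two-w two-p≢two-w
                      two-v-colour-repeats

mainTheorem16 : (n : ℕ) → 3 ≤ n → 2 ∣ n → (k : ℕ) → (col : Edge (2 * n) → Fin k) →
    IsOneFactorisation col → (v : Fin (2 * n)) →
      (Is2Config col v × Is3Config col (v +ᵥ 1)) ⊎ (Is3Config col v × Is2Config col (v +ᵥ 1))
mainTheorem16 (suc n) (s≤s 2≤n) _ k col isFactorisation v =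
  Configurations.configurations-alternate (n + suc (n + 0)) (s≤s (≤-trans 2≤n (m≤m+n n _)))
    isFactorisation v
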